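{- Let $n\ge1$ and let $H$ be a graph consisting of at least $n$ isolated vertices, with loops attached to at least $n$ of those vertices and no other edges. For each $\lambda\vdash n$, let $G_\lambda$ be any graph whose connected components have sizes equal to the parts of $\lambda$. Then $\{X_{G_\lambda}^H:\lambda\vdash n\}$ is a basis of $\Lambda^n$.
   Context: Graphs are finite and may have loops (an edge from a vertex to itself); a vertex with a loop counts as adjacent to itself. A graph homomorphism $f:G\to H$ is a map $V(G)\to V(H)$ such that whenever $u,v$ are adjacent in $G$ (possibly $u=v$ via a loop), $f(u),f(v)$ are adjacent in $H$. Its type is the partition of nonzero preimage sizes $|f^{ -1}(w)|$. For a partition $\lambda$ with $r_i(\lambda)$ parts equal to $i$ and $\ell(\lambda)\le N$, $m_\lambda^N=\frac{N!}{\binom{N}{r_1(\lambda),r_2(\lambda),\dots,N-\ell(\lambda)}}m_\lambda$ with $m_\lambda$ the monomial symmetric function. The $H$-chromatic symmetric function is $X_G^H=\sum_\lambda d_\lambda m_\lambda^{|V(H)|}$, $d_\lambda$ the number of homomorphisms $G\to H$ of type $\lambda$. $\Lambda^n$ is the $\mathbb{Q}$-vector space of homogeneous symmetric functions of degree $n$. -}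

module Defs where

open import Data.Bool using (Bool; true; false; T; not; _∧_; _∨_; if_then_else_)
open import Data.Nat using (ℕ; zero; suc; _∸_; _<_; _≟_; _<?_)
open import Data.Nat using (_!)
open import Data.Nat.ListAction using (sum; product)
open import Data.Nat.Properties using (≤-decTotalOrder)
open import Data.Fin using (Fin)
open import Data.Fin.Properties using (all?) renaming (_≟_ to _≟ᶠ_)
open import Data.Integer using (+_)
open import Data.Rational using (ℚ; 0ℚ; _+_; _*_; _/_)
open import Data.List using (List; []; _∷_; [_]; length; map; concatMap; filter;
  reverse; foldr; upTo; allFin; lookup)
open import Data.List.Properties using (≡-dec)
open import Data.List.Relation.Unary.All using (All)
open import Data.List.Relation.Unary.Linked using (Linked)
open import Data.List.Relation.Unary.Unique.Propositional using (Unique)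
open import Data.Vec.Functional as VF using ()
open import Data.Product using (Σ; ∃; _×_; _,_; proj₁; proj₂)
open import Relation.Binary.PropositionalEquality using (_≡_)
open import Relation.Binary.Construct.Closure.ReflexiveTransitive using (Star)
open import Relation.Nullary using (Dec; yes; no; does; ¬_)
open import Relation.Nullary.Decidable using (⌊_⌋)
import Data.List.Sort as Sort

-- Finite (undirected) graphs, possibly with loops.
-- Vertices are Fin size; adj is a symmetric Boolean adjacency relation;
-- adj v v ≡ true means v carries a loop.

record Graph : Set where
  field
    size : ℕ
    adj  : Fin size → Fin size → Bool
    sym  : ∀ u v → adj u v ≡ adj v u
open Graph public

_≥ℕ_ : ℕ → ℕ → Set
a ≥ℕ b = b Data.Nat.≤ a

record Partition (n : ℕ) : Set where
  field
    parts    : List ℕ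
    positive : All (0 <_) parts
    decr     : Linked _≥ℕ_ parts
    sums     : sum parts ≡ n
open Partition public

countᵇ : {A : Set} → (A → Bool) → List A → ℕ
countᵇ p []       = 0
countᵇ p (x ∷ xs) = if p x then suc (countᵇ p xs) else countᵇ p xs

IsHom : (G H : Graph) → (Fin (size G) → Fin (size H)) → Set
IsHom G H f = ∀ u v → T (adj G u v) → T (adj H (f u) (f v))

isHomᵇ : (G H : Graph) → (Fin (size G) → Fin (size H)) → Bool
isHomᵇ G H f =
  foldr _∧_ true
    (concatMap (λ u → map (λ v → not (adj G u v) ∨ adj H (f u) (f v))
                          (allFin (size G)))
               (allFin (size G)))

allMaps : (g h : ℕ) → List (Fin g → Fin h)
allMaps zero    h = [ (λ ()) ]
allMaps (suc g) h =
  concatMap (λ i → map (λ f → i VF.∷ f) (allMaps g h)) (allFin h)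

module ℕSort = Sort ≤-decTotalOrder

preimageSize : {g h : ℕ} → (Fin g → Fin h) → Fin h → ℕ
preimageSize {g} f w = countᵇ (λ v → ⌊ f v ≟ᶠ w ⌋) (allFin g)

mapType : {g h : ℕ} → (Fin g → Fin h) → List ℕ
mapType {g} {h} f =
  reverse (ℕSort.sort (filter (0 <?_) (map (preimageSize f) (allFin h))))

homCount : (G H : Graph) → List ℕ → ℕ
homCount G H μ =
  countᵇ (λ f → isHomᵇ G H f ∧ ⌊ ≡-dec _≟_ (mapType f) μ ⌋)
         (allMaps (size G) (size H))

-- Symmetric functions.
-- Λ^n is represented through its monomial basis {m_λ : λ ⊢ n}: an element
-- is its coefficient function Partition n → ℚ.

Sym : ℕ → Set
Sym n = Partition n → ℚ

mult : ℕ → List ℕ → ℕ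
mult i μ = countᵇ (λ j → ⌊ j ≟ i ⌋) μ

-- m_μ^N = (N! / multinomial(N; r_1, r_2, …, N - ℓ(μ))) m_μ
--       = r_1! r_2! ⋯ (N - ℓ(μ))! · m_μ.
-- (All i with r_i(μ) ≠ 0 lie in 1 … sum μ.)
mScale : ℕ → List ℕ → ℕ
mScale N μ = ((N ∸ length μ) !) Data.Nat.*
             product (map (λ i → (mult (suc i) μ) !) (upTo (sum μ)))

ℕtoℚ : ℕ → ℚ
ℕtoℚ k = (+ k) / 1

-- Coefficient of m_μ in X_G^H = Σ_λ d_λ m_λ^{|V(H)|}.
XGH : (G H : Graph) → List ℕ → ℚ
XGH G H μ = ℕtoℚ (homCount G H μ Data.Nat.* mScale (size H) μ)

linComb : {n : ℕ} → (Partition n → Sym n) → List (Partition n × ℚ) → Sym n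
linComb F L μ = foldr (λ p acc → (proj₂ p * F (proj₁ p) μ) + acc) 0ℚ L

IsBasis : {n : ℕ} → (Partition n → Sym n) → Set
IsBasis {n} F =
  (∀ (L : List (Partition n × ℚ)) →
     Unique (map (λ p → parts (proj₁ p)) L) →
     (∀ μ → linComb F L μ ≡ 0ℚ) →
     All (λ p → proj₂ p ≡ 0ℚ) L)
  ×
  (∀ (v : Sym n) → ∃ λ (L : List (Partition n × ℚ)) → ∀ μ → linComb F L μ ≡ v μ)

Connected : (G : Graph) → Fin (size G) → Fin (size G) → Set
Connected G = Star (λ u v → T (adj G u v))

-- The connected components of G have sizes equal to the parts of μ
-- (as a multiset): there is a labelling of the vertices by the positions
-- of μ whose fibres are exactly the connected components, and the fibre
-- over position i has exactly μ_i vertices.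
ComponentSizes : (G : Graph) → List ℕ → Set
ComponentSizes G μ =
  Σ (Fin (size G) → Fin (length μ)) λ c →
    (∀ u v → Connected G u v → c u ≡ c v) ×
    (∀ u v → c u ≡ c v → Connected G u v) ×
    (∀ i → countᵇ (λ v → ⌊ c v ≟ᶠ i ⌋) (allFin (size G)) ≡ lookup μ i)

NoEdgesBetweenDistinct : Graph → Set
NoEdgesBetweenDistinct H = ∀ u v → ¬ (u ≡ v) → adj H u v ≡ false

loopCount : Graph → ℕ
loopCount H = countᵇ (λ v → adj H v v) (allFin (size H))

-- H has no edges between distinct vertices, so a homomorphism G_λ → H is constant on every
-- connected component: it is a map F from the ℓ(λ) components to V(H), and its type is λ when F is
-- injective and has fewer than ℓ(λ) parts otherwise. Hence the coefficient of m_μ in X_{G_λ}^H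
-- vanishes unless μ = λ or ℓ(μ) < ℓ(λ), while the coefficient of m_λ is nonzero because the
-- components can be sent injectively to looped vertices. A family that is triangular for the length
-- of partitions and has nonzero diagonal is a basis.

module Submission where

open import Algebra.Properties.Group using (\\-leftDividesˡ)
open import Data.Bool using (Bool; true; false; T; not; _∧_; _∨_)
open import Data.Bool.Properties using (T-∧; T-≡)
open import Data.Empty using (⊥-elim)
open import Data.Fin as Fin using (Fin; punchIn; punchOut; inject≤) renaming (_≟_ to _≟ᶠ_)
import Data.Fin.Properties as Finₚ
open import Data.List using (List; []; _∷_; [_]; _++_; _∷ʳ_; map; foldr; filter; concatMap; reverse;
  tabulate; allFin; upTo; length; lookup; cartesianProductWith; mapMaybe; deduplicate)
import Data.List.Properties as Listₚ
open import Data.List.Membership.Propositional using (_∈_; find; lose)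
open import Data.List.Membership.Propositional.Properties
  using (∈-map⁺; ∈-concatMap⁺; ∈-cartesianProductWith⁺; ∈-upTo⁺; ∈-tabulate⁺; ∈-tabulate⁻;
         ∈-filter⁺; ∈-filter⁻; ∈-allFin; ∈-lookup; ∈-∃++; ∈-deduplicate⁺)
open import Data.List.Membership.Propositional.Properties.WithK using (unique∧set⇒bag)
open import Data.List.Relation.Binary.BagAndSetEquality using (∼bag⇒↭)
open import Data.List.Relation.Binary.Permutation.Propositional
  using (_↭_; ↭-trans; ↭-sym; ↭-reflexive; ↭⇒↭ₛ)
open import Data.List.Relation.Binary.Permutation.Propositional.Properties
  using (↭-reverse; ↭-length) renaming (map⁺ to ↭-map⁺)
open import Data.List.Relation.Binary.Pointwise using (Pointwise; Pointwise-≡⇒≡)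
open import Data.List.Relation.Unary.All as All using (All; []; _∷_)
import Data.List.Relation.Unary.All.Properties as Allₚ
open import Data.List.Relation.Unary.AllPairs using (AllPairs; []; _∷_)
open import Data.List.Relation.Unary.Any using (Any; here; there)
import Data.List.Relation.Unary.Any.Properties as Anyₚ
open import Data.List.Relation.Unary.Linked as Linked using (Linked; []; [-]; _∷_)
open import Data.List.Relation.Unary.Linked.Properties using (Linked⇒AllPairs)
open import Data.List.Relation.Unary.Sorted.TotalOrder.Properties using (↗↭↗⇒≋)
open import Data.List.Relation.Unary.Unique.Propositional using (Unique)
import Data.List.Relation.Unary.Unique.Propositional.Properties as Uniqueₚ
import Data.List.Relation.Unary.Unique.DecPropositional.Properties as DecUniqueₚ
open import Data.Maybe using (Maybe; just; nothing)
import Data.Maybe.Relation.Unary.Any as Maybe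
open import Data.Nat as ℕ using (ℕ; zero; suc; _∸_; _≤_; _<_; z≤n; s≤s; _≤?_; _<?_)
import Data.Nat.Properties as ℕₚ
open import Data.Nat.ListAction using (sum)
open import Data.Nat.ListAction.Properties using (product≢0)
open import Data.Product using (Σ; ∃; _×_; _,_; proj₁; proj₂)
open import Data.Rational as ℚ using (ℚ; 0ℚ; _+_; _*_; -_; _÷_)
import Data.Rational.Properties as ℚₚ
open import Data.Sum using (_⊎_; inj₁; inj₂)
import Data.Vec.Functional as Vector
open import Function using (_∘_; flip; mk⇔; Equivalence; Injective)
open import Relation.Binary.Construct.Closure.ReflexiveTransitive as Star using (ε; _◅_)
open import Relation.Binary.Definitions using (DecidableEquality)
open import Relation.Binary.PropositionalEquality
  using (_≡_; _≢_; _≗_; refl; sym; trans; cong; cong₂; subst; subst₂; ≢-sym; module ≡-Reasoning)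
open import Relation.Nullary using (Dec; yes; no; does; ¬_; T?; contradiction)
open import Relation.Nullary.Decidable
  using (⌊_⌋; toWitness; fromWitness; map′; decidable-stable; does-⇔; isYes≗does)
open import Relation.Unary using (Decidable)

open import Defs hiding (sym)

T-and⁻ : ∀ bs → T (foldr _∧_ true bs) → All T bs
T-and⁻ []       _ = []
T-and⁻ (b ∷ bs) t = proj₁ (Equivalence.to T-∧ t) ∷ T-and⁻ bs (proj₂ (Equivalence.to T-∧ t))

T-and⁺ : ∀ {bs} → All T bs → T (foldr _∧_ true bs)
T-and⁺ []         = _
T-and⁺ (tb ∷ tbs) = Equivalence.from T-∧ (tb , T-and⁺ tbs)

T-not∨⁻ : ∀ a b → T (not a ∨ b) → T a → T b
T-not∨⁻ true b t _ = t

T-not∨⁺ : ∀ a b → (T a → T b) → T (not a ∨ b)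
T-not∨⁺ false b _ = _
T-not∨⁺ true  b h = h _

module _ {A : Set} (p : A → Bool) where

  countᵇ-pos⁻ : ∀ xs → 0 < countᵇ p xs → Any (T ∘ p) xs
  countᵇ-pos⁻ (x ∷ xs) pos with p x in px
  ... | true  = here (Equivalence.from T-≡ px)
  ... | false = there (countᵇ-pos⁻ xs pos)

  countᵇ-pos⁺ : ∀ {xs} → Any (T ∘ p) xs → 0 < countᵇ p xs
  countᵇ-pos⁺ (here px) rewrite Equivalence.to T-≡ px = s≤s z≤n
  countᵇ-pos⁺ {x ∷ _} (there any) with p x
  ... | true  = s≤s z≤n
  ... | false = countᵇ-pos⁺ any

  countᵇ≡length∘filter : ∀ xs → countᵇ p xs ≡ length (filter (T? ∘ p) xs)
  countᵇ≡length∘filter []       = refl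
  countᵇ≡length∘filter (x ∷ xs) with p x
  ... | true  = cong suc (countᵇ≡length∘filter xs)
  ... | false = countᵇ≡length∘filter xs

countᵇ-cong : ∀ {A : Set} {p q : A → Bool} → p ≗ q → countᵇ p ≗ countᵇ q
countᵇ-cong p≗q []       = refl
countᵇ-cong p≗q (x ∷ xs) rewrite p≗q x | countᵇ-cong p≗q xs = refl

module _ {A : Set} where

  ∈-++-remove : ∀ as {bs : List A} {x y} → y ∈ as ++ x ∷ bs → y ≢ x → y ∈ as ++ bs
  ∈-++-remove as y∈ y≢x with Anyₚ.++⁻ as y∈
  ... | inj₁ y∈as         = Anyₚ.++⁺ˡ y∈as
  ... | inj₂ (here y≡x)   = contradiction y≡x y≢x
  ... | inj₂ (there y∈bs) = Anyₚ.++⁺ʳ as y∈bs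

  Unique-⊆⇒length≤ : ∀ {xs ys : List A} → Unique xs → (∀ {x} → x ∈ xs → x ∈ ys) →
                     length xs ≤ length ys
  Unique-⊆⇒length≤ {[]}     _              _     = z≤n
  Unique-⊆⇒length≤ {x ∷ xs} (x∉xs ∷ xs!) xs⊆ys with ∈-∃++ (xs⊆ys (here refl))
  ... | as , bs , refl = ℕₚ.≤-trans (s≤s (Unique-⊆⇒length≤ xs! xs⊆as++bs))
                                    (ℕₚ.≤-reflexive (sym (Listₚ.length-++-sucʳ as x bs)))
    where
    xs⊆as++bs : ∀ {y} → y ∈ xs → y ∈ as ++ bs
    xs⊆as++bs y∈xs = ∈-++-remove as (xs⊆ys (there y∈xs)) (≢-sym (All.lookup x∉xs y∈xs))

  -- Without F i the family F ∘ punchIn i still covers xs, and it has one member fewer.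
  collision⇒length< : ∀ {ℓ} (F : Fin ℓ → A) {xs} → Unique xs →
                      (∀ {w} → w ∈ xs → ∃ λ k → F k ≡ w) →
                      ∀ {i j} → i ≢ j → F i ≡ F j → length xs < ℓ
  collision⇒length< {zero}  F _  _       {()}
  collision⇒length< {suc ℓ} F {xs} xs! covered {i} {j} i≢j Fi≡Fj =
    s≤s (ℕₚ.≤-trans (Unique-⊆⇒length≤ xs! xs⊆)
                    (ℕₚ.≤-reflexive (Listₚ.length-tabulate (F ∘ punchIn i))))
    where
    avoiding-i : ∀ k → ∃ λ k′ → F (punchIn i k′) ≡ F k
    avoiding-i k with k ≟ᶠ i
    ... | yes refl = punchOut i≢j , trans (cong F (Finₚ.punchIn-punchOut i≢j)) (sym Fi≡Fj)
    ... | no  k≢i  = punchOut (≢-sym k≢i) , cong F (Finₚ.punchIn-punchOut (≢-sym k≢i))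
    xs⊆ : ∀ {w} → w ∈ xs → w ∈ tabulate (F ∘ punchIn i)
    xs⊆ w∈xs with covered w∈xs
    ... | k , refl with avoiding-i k
    ... | k′ , eq = subst (_∈ tabulate (F ∘ punchIn i)) eq (∈-tabulate⁺ k′)

  lookup-injective : ∀ {xs : List A} → Unique xs → Injective _≡_ _≡_ (lookup xs)
  lookup-injective {_ ∷ _} _          {Fin.zero}  {Fin.zero}  _  = refl
  lookup-injective {_ ∷ _} (x∉xs ∷ _) {Fin.zero}  {Fin.suc j} eq =
    contradiction eq (All.lookup x∉xs (∈-lookup j))
  lookup-injective {_ ∷ _} (x∉xs ∷ _) {Fin.suc i} {Fin.zero}  eq =
    contradiction (sym eq) (All.lookup x∉xs (∈-lookup i))
  lookup-injective {_ ∷ _} (_ ∷ xs!)  {Fin.suc i} {Fin.suc j} eq =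
    cong Fin.suc (lookup-injective xs! eq)

filter-map : ∀ {A B : Set} {P : B → Set} (P? : Decidable P) (h : A → B) xs →
             filter P? (map h xs) ≡ map h (filter (P? ∘ h) xs)
filter-map P? h []       = refl
filter-map P? h (x ∷ xs) with does (P? (h x))
... | true  = cong (h x ∷_) (filter-map P? h xs)
... | false = filter-map P? h xs

Linked-∷ʳ : ∀ {A : Set} {R : A → A → Set} {ys x} → Linked R ys → All (λ y → R y x) ys →
            Linked R (ys ∷ʳ x)
Linked-∷ʳ []      []       = [-]
Linked-∷ʳ [-]     (r ∷ []) = r ∷ [-]
Linked-∷ʳ (r ∷ l) (_ ∷ rs) = r ∷ Linked-∷ʳ l rs

AllPairs⇒Linked-reverse : ∀ {A : Set} {R : A → A → Set} {xs} → AllPairs R xs →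
                          Linked (flip R) (reverse xs)
AllPairs⇒Linked-reverse [] = []
AllPairs⇒Linked-reverse {xs = x ∷ xs} (rx ∷ rxs) rewrite Listₚ.unfold-reverse x xs =
  Linked-∷ʳ (AllPairs⇒Linked-reverse rxs) (All.tabulate λ y∈ → All.lookup rx (Anyₚ.reverse⁻ y∈))

reverse-sort≡decreasing : ∀ {xs ys} → Linked _≥ℕ_ ys → xs ↭ ys → reverse (ℕSort.sort xs) ≡ ys
reverse-sort≡decreasing {xs} {ys} ys↘ xs↭ys = begin
  reverse (ℕSort.sort xs)  ≡⟨ cong reverse (Pointwise-≡⇒≡ sort≋reverse-ys) ⟩
  reverse (reverse ys)     ≡⟨ Listₚ.reverse-involutive ys ⟩
  ys                       ∎
  where
  open ≡-Reasoning
  reverse-ys↗ : Linked _≤_ (reverse ys)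
  reverse-ys↗ = AllPairs⇒Linked-reverse (Linked⇒AllPairs (λ p q → ℕₚ.≤-trans q p) ys↘)
  sort↭ : ℕSort.sort xs ↭ reverse ys
  sort↭ = ↭-trans (ℕSort.sort-↭ xs) (↭-trans xs↭ys (↭-sym (↭-reverse ys)))
  sort≋reverse-ys : Pointwise _≡_ (ℕSort.sort xs) (reverse ys)
  sort≋reverse-ys = ↗↭↗⇒≋ ℕₚ.≤-totalOrder (ℕSort.sort-↗ xs) reverse-ys↗ (↭⇒↭ₛ sort↭)

parts-injective : ∀ {n} {μ ν : Partition n} → parts μ ≡ parts ν → μ ≡ ν
parts-injective {μ = record { positive = pos ; decr = dec ; sums = sum≡ }}
                {ν = record { positive = pos′ ; decr = dec′ ; sums = sum≡′ }} refl
  with All.irrelevant ℕₚ.≤-irrelevant pos pos′ | Linked.irrelevant ℕₚ.≤-irrelevant dec dec′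
     | ℕₚ.≡-irrelevant sum≡ sum≡′
... | refl | refl | refl = refl

_≟ₚ_ : ∀ {n} → DecidableEquality (Partition n)
μ ≟ₚ ν = map′ parts-injective (cong parts) (Listₚ.≡-dec ℕ._≟_ (parts μ) (parts ν))

length≤sum : ∀ {xs} → All (0 <_) xs → length xs ≤ sum xs
length≤sum []         = z≤n
length≤sum (x>0 ∷ xs) = ℕₚ.+-mono-≤ x>0 (length≤sum xs)

length-parts≤ : ∀ {n} (μ : Partition n) → length (parts μ) ≤ n
length-parts≤ μ = subst (length (parts μ) ≤_) (sums μ) (length≤sum (positive μ))

∈⇒≤sum : ∀ {x xs} → x ∈ xs → x ≤ sum xs
∈⇒≤sum {xs = _ ∷ xs} (here refl) = ℕₚ.m≤m+n _ (sum xs)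
∈⇒≤sum {xs = y ∷ _}  (there x∈)  = ℕₚ.≤-trans (∈⇒≤sum x∈) (ℕₚ.m≤n+m _ y)

listsBelow : ℕ → ℕ → List (List ℕ)
listsBelow b zero    = [ [] ]
listsBelow b (suc l) = cartesianProductWith _∷_ (upTo b) (listsBelow b l)

∈-listsBelow : ∀ {b xs} → All (_< b) xs → xs ∈ listsBelow b (length xs)
∈-listsBelow []           = here refl
∈-listsBelow (x<b ∷ xs<b) = ∈-cartesianProductWith⁺ _∷_ (∈-upTo⁺ x<b) (∈-listsBelow xs<b)

boundedLists : ℕ → List (List ℕ)
boundedLists n = concatMap (listsBelow (suc n)) (upTo (suc n))

∈-boundedLists : ∀ {n xs} → All (_≤ n) xs → length xs ≤ n → xs ∈ boundedLists n
∈-boundedLists {n} xs≤n length≤n =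
  ∈-concatMap⁺ (listsBelow (suc n)) (lose (∈-upTo⁺ (s≤s length≤n)) (∈-listsBelow (All.map s≤s xs≤n)))

toPartition : ∀ {n} → List ℕ → Maybe (Partition n)
toPartition {n} xs with All.all? (0 <?_) xs | Linked.linked? (flip _≤?_) xs | sum xs ℕ.≟ n
... | yes pos | yes dec | yes sum≡n =
  just record { parts = xs ; positive = pos ; decr = dec ; sums = sum≡n }
... | _ | _ | _ = nothing

toPartition-parts : ∀ {n} (μ : Partition n) → toPartition (parts μ) ≡ just μ
toPartition-parts {n} μ
  with All.all? (0 <?_) (parts μ) | Linked.linked? (flip _≤?_) (parts μ) | sum (parts μ) ℕ.≟ n
... | yes _   | yes _   | yes _   = cong just (parts-injective refl)
... | no ¬pos | _       | _       = contradiction (positive μ) ¬pos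
... | yes _   | no ¬dec | _       = contradiction (decr μ) ¬dec
... | yes _   | yes _   | no ¬sum = contradiction (sums μ) ¬sum

partitions : ∀ n → List (Partition n)
partitions n = deduplicate _≟ₚ_ (mapMaybe toPartition (boundedLists n))

partitions-unique : ∀ n → Unique (map parts (partitions n))
partitions-unique n =
  Uniqueₚ.map⁺ parts-injective (DecUniqueₚ.deduplicate-! _≟ₚ_ (mapMaybe toPartition (boundedLists n)))

∈-partitions : ∀ {n} (μ : Partition n) → μ ∈ partitions n
∈-partitions {n} μ =
  ∈-deduplicate⁺ _≟ₚ_ (Anyₚ.mapMaybe⁺ toPartition (boundedLists n) (Anyₚ.map⁺ (lose parts∈ μ∈)))
  where
  parts∈ : parts μ ∈ boundedLists n
  parts∈ = ∈-boundedLists (All.tabulate λ x∈ → subst (_ ≤_) (sums μ) (∈⇒≤sum x∈)) (length-parts≤ μ)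
  μ∈ : Maybe.Any (μ ≡_) (toPartition (parts μ))
  μ∈ = subst (Maybe.Any (μ ≡_)) (sym (toPartition-parts μ)) (Maybe.just refl)

∑ : ∀ {A : Set} → (A → ℚ) → List A → ℚ
∑ g = foldr (λ x acc → g x + acc) 0ℚ

module _ {A : Set} (g : A → ℚ) where

  ∑-zero : ∀ {xs} → (∀ {x} → x ∈ xs → g x ≡ 0ℚ) → ∑ g xs ≡ 0ℚ
  ∑-zero {[]}     _     = refl
  ∑-zero {x ∷ xs} g≡0 = cong₂ _+_ (g≡0 (here refl)) (∑-zero (g≡0 ∘ there))

  ∑-++ : ∀ xs {ys} → ∑ g (xs ++ ys) ≡ ∑ g xs + ∑ g ys
  ∑-++ []       = sym (ℚₚ.+-identityˡ _)
  ∑-++ (x ∷ xs) = trans (cong (g x +_) (∑-++ xs)) (sym (ℚₚ.+-assoc (g x) _ _))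

  ∑-single : ∀ {B : Set} (key : A → B) {xs x} → Unique (map key xs) → x ∈ xs →
             (∀ {y} → y ∈ xs → key y ≢ key x → g y ≡ 0ℚ) → ∑ g xs ≡ g x
  ∑-single key {x ∷ xs} (x∉xs ∷ _) (here refl) g≡0 = begin
    g x + ∑ g xs  ≡⟨ cong (g x +_) (∑-zero λ y∈xs → g≡0 (there y∈xs) (≢-sym (key-differs y∈xs))) ⟩
    g x + 0ℚ      ≡⟨ ℚₚ.+-identityʳ (g x) ⟩
    g x           ∎
    where
    open ≡-Reasoning
    key-differs : ∀ {y} → y ∈ xs → key x ≢ key y
    key-differs = All.lookup (Allₚ.map⁻ x∉xs)
  ∑-single key {y ∷ xs} {x} (y∉xs ∷ xs!) (there x∈xs) g≡0 = begin
    g y + ∑ g xs  ≡⟨ cong₂ _+_ (g≡0 (here refl) (All.lookup (Allₚ.map⁻ y∉xs) x∈xs))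
                               (∑-single key xs! x∈xs (g≡0 ∘ there)) ⟩
    0ℚ + g x      ≡⟨ ℚₚ.+-identityˡ (g x) ⟩
    g x           ∎
    where open ≡-Reasoning

∑-map : ∀ {A B : Set} (g : B → ℚ) (h : A → B) xs → ∑ g (map h xs) ≡ ∑ (g ∘ h) xs
∑-map g h []       = refl
∑-map g h (x ∷ xs) = cong (g (h x) +_) (∑-map g h xs)

linComb-++ : ∀ {n} (F : Partition n → Sym n) L {L′} μ →
             linComb F (L ++ L′) μ ≡ linComb F L μ + linComb F L′ μ
linComb-++ F L μ = ∑-++ (λ p → proj₂ p * F (proj₁ p) μ) L

*≡0⇒≡0 : ∀ p {q} → q ≢ 0ℚ → p * q ≡ 0ℚ → p ≡ 0ℚ
*≡0⇒≡0 p {q} q≢0 pq≡0 = begin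
  p                  ≡⟨ sym (ℚₚ.*-identityʳ p) ⟩
  p * ℚ.1ℚ           ≡⟨ cong (p *_) (sym (ℚₚ.*-inverseʳ q)) ⟩
  p * (q * ℚ.1/ q)   ≡⟨ sym (ℚₚ.*-assoc p q _) ⟩
  (p * q) * ℚ.1/ q   ≡⟨ cong (_* _) pq≡0 ⟩
  0ℚ * ℚ.1/ q        ≡⟨ ℚₚ.*-zeroˡ (ℚ.1/ q) ⟩
  0ℚ                 ∎
  where
  open ≡-Reasoning
  instance q≠0 : ℚ.NonZero q
  q≠0 = ℚ.≢-nonZero q≢0

÷-*-cancel : ∀ p q .{{_ : ℚ.NonZero q}} → (p ÷ q) * q ≡ p
÷-*-cancel p q = begin
  (p * ℚ.1/ q) * q  ≡⟨ ℚₚ.*-assoc p _ q ⟩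
  p * (ℚ.1/ q * q)  ≡⟨ cong (p *_) (ℚₚ.*-inverseˡ q) ⟩
  p * ℚ.1ℚ          ≡⟨ ℚₚ.*-identityʳ p ⟩
  p                 ∎
  where open ≡-Reasoning

module Triangular {n b : ℕ} (rank : Partition n → ℕ) (rank≤b : ∀ μ → rank μ ≤ b)
  (F : Partition n → Sym n)
  (F-vanishes : ∀ λ′ μ → rank λ′ ≤ rank μ → μ ≢ λ′ → F λ′ μ ≡ 0ℚ)
  (F-diagonal : ∀ λ′ → F λ′ λ′ ≢ 0ℚ) where

  module _ (L : List (Partition n × ℚ)) (L! : Unique (map (parts ∘ proj₁) L))
           (L-null : ∀ μ → linComb F L μ ≡ 0ℚ) where

    RanksBelow : ℕ → Set
    RanksBelow k = ∀ {p} → p ∈ L → proj₂ p ≢ 0ℚ → rank (proj₁ p) < k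

    linComb-at-top : ∀ {λ′ c} → (λ′ , c) ∈ L → RanksBelow (suc (rank λ′)) →
                     linComb F L λ′ ≡ c * F λ′ λ′
    linComb-at-top {λ′} p∈L below = ∑-single _ (parts ∘ proj₁) L! p∈L off-diagonal
      where
      off-diagonal : ∀ {q} → q ∈ L → parts (proj₁ q) ≢ parts λ′ → proj₂ q * F (proj₁ q) λ′ ≡ 0ℚ
      off-diagonal {ν , d} q∈L ν≢λ′ with d ℚ.≟ 0ℚ
      ... | yes refl = ℚₚ.*-zeroˡ (F ν λ′)
      ... | no  d≢0  = trans (cong (d *_) F≡0) (ℚₚ.*-zeroʳ d)
        where
        F≡0 : F ν λ′ ≡ 0ℚ
        F≡0 = F-vanishes ν λ′ (ℕₚ.≤-pred (below q∈L d≢0)) (ν≢λ′ ∘ cong parts ∘ sym)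

    below-suc⇒below : ∀ {k} → RanksBelow (suc k) → RanksBelow k
    below-suc⇒below {k} below {λ′ , c} p∈L c≢0 with rank λ′ ℕ.≟ k
    ... | no  rank≢k = ℕₚ.≤∧≢⇒< (ℕₚ.≤-pred (below p∈L c≢0)) rank≢k
    ... | yes refl   = contradiction c≡0 c≢0
      where
      c≡0 : c ≡ 0ℚ
      c≡0 = *≡0⇒≡0 c (F-diagonal λ′) (trans (sym (linComb-at-top p∈L below)) (L-null λ′))

    below⇒null : ∀ k → RanksBelow k → All (λ p → proj₂ p ≡ 0ℚ) L
    below⇒null zero    below = All.tabulate λ {(_ , c)} p∈L →
      decidable-stable (c ℚ.≟ 0ℚ) (λ c≢0 → ℕₚ.n≮0 (below p∈L c≢0))
    below⇒null (suc k) below = below⇒null k (below-suc⇒below below)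

    independent : All (λ p → proj₂ p ≡ 0ℚ) L
    independent = below⇒null (suc b) (λ {p} _ _ → s≤s (rank≤b (proj₁ p)))

  Spanned : Sym n → Set
  Spanned v = ∃ λ L → ∀ μ → linComb F L μ ≡ v μ

  module _ (k : ℕ) (v : Sym n) (v-vanishes : ∀ μ → suc k ≤ rank μ → v μ ≡ 0ℚ) where

    coefficient : ∀ λ′ → Dec (rank λ′ ≡ k) → ℚ
    coefficient λ′ (yes _) = (v λ′ ÷ F λ′ λ′) {{ℚ.≢-nonZero (F-diagonal λ′)}}
    coefficient λ′ (no  _) = 0ℚ

    topPart : List (Partition n × ℚ)
    topPart = map (λ λ′ → λ′ , coefficient λ′ (rank λ′ ℕ.≟ k)) (partitions n)

    module _ {μ} (k≤rank : k ≤ rank μ) where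

      off-diagonal : ∀ {λ′} → μ ≢ λ′ → ∀ rank≟k → coefficient λ′ rank≟k * F λ′ μ ≡ 0ℚ
      off-diagonal {λ′} μ≢λ′ (yes rank≡k) =
        trans (cong (coefficient λ′ (yes rank≡k) *_) F≡0) (ℚₚ.*-zeroʳ (coefficient λ′ (yes rank≡k)))
        where
        F≡0 : F λ′ μ ≡ 0ℚ
        F≡0 = F-vanishes λ′ μ (subst (_≤ rank μ) (sym rank≡k) k≤rank) μ≢λ′
      off-diagonal {λ′} μ≢λ′ (no _) = ℚₚ.*-zeroˡ (F λ′ μ)

      diagonal : ∀ rank≟k → coefficient μ rank≟k * F μ μ ≡ v μ
      diagonal (yes _)      = ÷-*-cancel (v μ) (F μ μ) {{ℚ.≢-nonZero (F-diagonal μ)}}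
      diagonal (no rank≢k) =
        trans (ℚₚ.*-zeroˡ (F μ μ)) (sym (v-vanishes μ (ℕₚ.≤∧≢⇒< k≤rank (≢-sym rank≢k))))

      linComb-topPart : linComb F topPart μ ≡ v μ
      linComb-topPart = begin
        linComb F topPart μ
          ≡⟨ ∑-map term (λ λ′ → λ′ , coefficient λ′ (rank λ′ ℕ.≟ k)) (partitions n) ⟩
        ∑ (λ λ′ → coefficient λ′ (rank λ′ ℕ.≟ k) * F λ′ μ) (partitions n)
          ≡⟨ ∑-single _ parts (partitions-unique n) (∈-partitions μ)
                      (λ _ λ′≢μ → off-diagonal (λ′≢μ ∘ cong parts ∘ sym) (rank _ ℕ.≟ k)) ⟩
        coefficient μ (rank μ ℕ.≟ k) * F μ μ
          ≡⟨ diagonal (rank μ ℕ.≟ k) ⟩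
        v μ
          ∎
        where
        open ≡-Reasoning
        term : Partition n × ℚ → ℚ
        term (λ′ , a) = a * F λ′ μ

  spanned-below : ∀ k v → (∀ μ → k ≤ rank μ → v μ ≡ 0ℚ) → Spanned v
  spanned-below zero    v v≡0      = [] , λ μ → sym (v≡0 μ z≤n)
  spanned-below (suc k) v vanishes = top ++ rest , λ μ → begin
    linComb F (top ++ rest) μ                    ≡⟨ linComb-++ F top μ ⟩
    linComb F top μ + linComb F rest μ           ≡⟨ cong (linComb F top μ +_) (proj₂ spanned-rest μ) ⟩
    linComb F top μ + (- linComb F top μ + v μ)  ≡⟨ \\-leftDividesˡ ℚₚ.+-0-group (linComb F top μ) (v μ) ⟩
    v μ                                          ∎
    where
    open ≡-Reasoning
    top : List (Partition n × ℚ)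
    top = topPart k v vanishes
    spanned-rest : Spanned (λ μ → - linComb F top μ + v μ)
    spanned-rest = spanned-below k _ λ μ k≤rank →
      trans (cong (λ t → - t + v μ) (linComb-topPart k v vanishes k≤rank)) (ℚₚ.+-inverseˡ (v μ))
    rest : List (Partition n × ℚ)
    rest = proj₁ spanned-rest

  isBasis : IsBasis F
  isBasis = independent , λ v →
    spanned-below (suc b) v λ μ b<rank → contradiction (rank≤b μ) (ℕₚ.<⇒≱ b<rank)

module _ {g N : ℕ} where

  preimageSize-cong : ∀ {f f′ : Fin g → Fin N} → f ≗ f′ → preimageSize f ≗ preimageSize f′
  preimageSize-cong f≗f′ w = countᵇ-cong (λ v → cong (λ a → ⌊ a ≟ᶠ w ⌋) (f≗f′ v)) (allFin g)

  mapType-cong : ∀ {f f′ : Fin g → Fin N} → f ≗ f′ → mapType f ≡ mapType f′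
  mapType-cong f≗f′ = cong (λ sizes → reverse (ℕSort.sort (filter (0 <?_) sizes)))
                           (Listₚ.map-cong (preimageSize-cong f≗f′) (allFin N))

  module _ (f : Fin g → Fin N) where

    preimageSize-pos⁻ : ∀ {w} → 0 < preimageSize f w → ∃ λ v → f v ≡ w
    preimageSize-pos⁻ pos with find (countᵇ-pos⁻ _ (allFin g) pos)
    ... | v , _ , fv≟w = v , toWitness fv≟w

    preimageSize-pos⁺ : ∀ {v w} → f v ≡ w → 0 < preimageSize f w
    preimageSize-pos⁺ {v} fv≡w = countᵇ-pos⁺ _ (lose (∈-allFin v) (fromWitness fv≡w))

  image : (Fin g → Fin N) → List (Fin N)
  image f = filter (λ w → 0 <? preimageSize f w) (allFin N)

  module _ (f : Fin g → Fin N) where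

    image-unique : Unique (image f)
    image-unique = Uniqueₚ.filter⁺ _ (Uniqueₚ.allFin⁺ N)

    ∈-image⁻ : ∀ {w} → w ∈ image f → ∃ λ v → f v ≡ w
    ∈-image⁻ w∈ =
      preimageSize-pos⁻ f (proj₂ (∈-filter⁻ (λ w → 0 <? preimageSize f w) {xs = allFin N} w∈))

    ∈-image⁺ : ∀ v → f v ∈ image f
    ∈-image⁺ v = ∈-filter⁺ _ (∈-allFin (f v)) (preimageSize-pos⁺ f refl)

    mapType-image : mapType f ≡ reverse (ℕSort.sort (map (preimageSize f) (image f)))
    mapType-image = cong (reverse ∘ ℕSort.sort) (filter-map (0 <?_) (preimageSize f) (allFin N))

    length-mapType : length (mapType f) ≡ length (image f)
    length-mapType = begin
      length (mapType f)                   ≡⟨ cong length mapType-image ⟩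
      length (reverse (ℕSort.sort sizes))  ≡⟨ Listₚ.length-reverse (ℕSort.sort sizes) ⟩
      length (ℕSort.sort sizes)            ≡⟨ ↭-length (ℕSort.sort-↭ sizes) ⟩
      length sizes                         ≡⟨ Listₚ.length-map (preimageSize f) (image f) ⟩
      length (image f)                     ∎
      where
      open ≡-Reasoning
      sizes : List ℕ
      sizes = map (preimageSize f) (image f)

module Factored {g : ℕ} {λs : List ℕ} (c : Fin g → Fin (length λs))
                (fibres : ∀ i → preimageSize c i ≡ lookup λs i) (λs-positive : All (0 <_) λs) where

  c-surjective : ∀ i → ∃ λ u → c u ≡ i
  c-surjective i =
    preimageSize-pos⁻ c (subst (0 <_) (sym (fibres i)) (All.lookup λs-positive (∈-lookup i)))

  section : Fin (length λs) → Fin g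
  section i = proj₁ (c-surjective i)

  section-correct : ∀ i → c (section i) ≡ i
  section-correct i = proj₂ (c-surjective i)

  module _ {N : ℕ} (F : Fin (length λs) → Fin N) where

    ∈-image-∘⁻ : ∀ {w} → w ∈ image (F ∘ c) → ∃ λ i → F i ≡ w
    ∈-image-∘⁻ w∈ with ∈-image⁻ (F ∘ c) w∈
    ... | u , Fcu≡w = c u , Fcu≡w

    ∈-image-∘⁺ : ∀ i → F i ∈ image (F ∘ c)
    ∈-image-∘⁺ i with c-surjective i
    ... | u , refl = ∈-image⁺ (F ∘ c) u

    image-∘-length< : ∀ {i j} → i ≢ j → F i ≡ F j → length (image (F ∘ c)) < length λs
    image-∘-length< = collision⇒length< F (image-unique (F ∘ c)) ∈-image-∘⁻

    module _ (F-injective : Injective _≡_ _≡_ F) where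

      image-∘↭ : image (F ∘ c) ↭ tabulate F
      image-∘↭ =
        ∼bag⇒↭ (unique∧set⇒bag (image-unique (F ∘ c)) (Uniqueₚ.tabulate⁺ F-injective) (mk⇔ to from))
        where
        to : ∀ {w} → w ∈ image (F ∘ c) → w ∈ tabulate F
        to w∈ with ∈-image-∘⁻ w∈
        ... | i , refl = ∈-tabulate⁺ i
        from : ∀ {w} → w ∈ tabulate F → w ∈ image (F ∘ c)
        from w∈ with ∈-tabulate⁻ w∈
        ... | i , refl = ∈-image-∘⁺ i

      preimageSize-∘ : ∀ i → preimageSize (F ∘ c) (F i) ≡ preimageSize c i
      preimageSize-∘ i = countᵇ-cong same-test (allFin g)
        where
        same-test : ∀ u → ⌊ F (c u) ≟ᶠ F i ⌋ ≡ ⌊ c u ≟ᶠ i ⌋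
        same-test u = begin
          ⌊ F (c u) ≟ᶠ F i ⌋     ≡⟨ isYes≗does (F (c u) ≟ᶠ F i) ⟩
          does (F (c u) ≟ᶠ F i)  ≡⟨ does-⇔ (mk⇔ F-injective (cong F)) (F (c u) ≟ᶠ F i) (c u ≟ᶠ i) ⟩
          does (c u ≟ᶠ i)        ≡⟨ sym (isYes≗does (c u ≟ᶠ i)) ⟩
          ⌊ c u ≟ᶠ i ⌋           ∎
          where open ≡-Reasoning

      mapType-∘-injective : Linked _≥ℕ_ λs → mapType (F ∘ c) ≡ λs
      mapType-∘-injective λs↘ = trans (mapType-image (F ∘ c)) (reverse-sort≡decreasing λs↘ sizes↭λs)
        where
        open ≡-Reasoning
        size-F : ∀ i → preimageSize (F ∘ c) (F i) ≡ lookup λs i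
        size-F i = trans (preimageSize-∘ i) (fibres i)
        sizes↭λs : map (preimageSize (F ∘ c)) (image (F ∘ c)) ↭ λs
        sizes↭λs = ↭-trans (↭-map⁺ (preimageSize (F ∘ c)) image-∘↭) (↭-reflexive (begin
          map (preimageSize (F ∘ c)) (tabulate F)  ≡⟨ Listₚ.map-tabulate F (preimageSize (F ∘ c)) ⟩
          tabulate (preimageSize (F ∘ c) ∘ F)      ≡⟨ Listₚ.tabulate-cong size-F ⟩
          tabulate (lookup λs)                     ≡⟨ Listₚ.tabulate-lookup λs ⟩
          λs                                       ∎))

    mapType-∘ : Linked _≥ℕ_ λs → mapType (F ∘ c) ≡ λs ⊎ length (mapType (F ∘ c)) < length λs
    mapType-∘ λs↘ with length (image (F ∘ c)) <? length λs
    ... | yes shorter = inj₂ (subst (_< length λs) (sym (length-mapType (F ∘ c))) shorter)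
    ... | no ¬shorter = inj₁ (mapType-∘-injective F-injective λs↘)
      where
      F-injective : Injective _≡_ _≡_ F
      F-injective {i} {j} Fi≡Fj with i ≟ᶠ j
      ... | yes i≡j = i≡j
      ... | no  i≢j = contradiction (image-∘-length< i≢j Fi≡Fj) ¬shorter

module _ (G H : Graph) where

  private
    preserved : (Fin (size G) → Fin (size H)) → Fin (size G) → Fin (size G) → Bool
    preserved f u v = not (adj G u v) ∨ adj H (f u) (f v)

  isHomᵇ-sound : ∀ f → T (isHomᵇ G H f) → IsHom G H f
  isHomᵇ-sound f isHom u v = T-not∨⁻ (adj G u v) (adj H (f u) (f v)) (All.lookup (row u) (∈-allFin v))
    where
    rows : All (λ u → All T (map (preserved f u) (allFin (size G)))) (allFin (size G))
    rows = Allₚ.map⁻ (Allₚ.concat⁻ (T-and⁻ (concatMap _ (allFin (size G))) isHom))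
    row : ∀ u → All (T ∘ preserved f u) (allFin (size G))
    row u = Allₚ.map⁻ (All.lookup rows (∈-allFin u))

  isHomᵇ-complete : ∀ f → IsHom G H f → T (isHomᵇ G H f)
  isHomᵇ-complete f hom = T-and⁺ (Allₚ.concat⁺ (Allₚ.map⁺ (All.universal row (allFin (size G)))))
    where
    row : ∀ u → All T (map (preserved f u) (allFin (size G)))
    row u = Allₚ.map⁺ (All.universal (λ v → T-not∨⁺ (adj G u v) (adj H (f u) (f v)) (hom u v)) _)

  IsHom-cong : ∀ {f f′} → f ≗ f′ → IsHom G H f → IsHom G H f′
  IsHom-cong f≗f′ hom u v uv = subst₂ (λ a b → T (adj H a b)) (f≗f′ u) (f≗f′ v) (hom u v uv)

allMaps-complete : ∀ {g h} (f : Fin g → Fin h) → ∃ λ f′ → f′ ∈ allMaps g h × f′ ≗ f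
allMaps-complete {zero}  f = _ , here refl , λ ()
allMaps-complete {suc g} {h} f with allMaps-complete (f ∘ Fin.suc)
... | f′ , f′∈ , f′≗ = f Fin.zero Vector.∷ f′ , ∷f′∈ , agree
  where
  ∷f′∈ : (f Fin.zero Vector.∷ f′) ∈ allMaps (suc g) h
  ∷f′∈ = ∈-concatMap⁺ _ (lose (∈-allFin (f Fin.zero)) (∈-map⁺ (f Fin.zero Vector.∷_) f′∈))
  agree : (f Fin.zero Vector.∷ f′) ≗ f
  agree Fin.zero    = refl
  agree (Fin.suc x) = f′≗ x

module _ (G H : Graph) {μ : List ℕ} where

  homCount-pos⁻ : 0 < homCount G H μ → ∃ λ f → IsHom G H f × mapType f ≡ μ
  homCount-pos⁻ pos with find (countᵇ-pos⁻ _ (allMaps (size G) (size H)) pos)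
  ... | f , _ , hom∧type with Equivalence.to T-∧ hom∧type
  ... | hom , type≡μ = f , isHomᵇ-sound G H f hom , toWitness type≡μ

  homCount-pos⁺ : ∀ {f} → IsHom G H f → mapType f ≡ μ → 0 < homCount G H μ
  homCount-pos⁺ {f} hom type≡μ with allMaps-complete f
  ... | f′ , f′∈ , f′≗f = countᵇ-pos⁺ _ (lose f′∈ (Equivalence.from T-∧ (hom′ , fromWitness type′≡μ)))
    where
    hom′ : T (isHomᵇ G H f′)
    hom′ = isHomᵇ-complete G H f′ (IsHom-cong G H (sym ∘ f′≗f) hom)
    type′≡μ : mapType f′ ≡ μ
    type′≡μ = trans (mapType-cong f′≗f) type≡μ

module _ {G H : Graph} (no-edges : NoEdgesBetweenDistinct H) {f} (hom : IsHom G H f) where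

  hom-constant-on-edges : ∀ {u v} → T (adj G u v) → f u ≡ f v
  hom-constant-on-edges {u} {v} uv with f u ≟ᶠ f v
  ... | yes fu≡fv = fu≡fv
  ... | no  fu≢fv = ⊥-elim (subst T (no-edges _ _ fu≢fv) (hom u v uv))

  hom-constant-on-components : ∀ {u v} → Connected G u v → f u ≡ f v
  hom-constant-on-components = Star.fold (λ u v → f u ≡ f v) (trans ∘ hom-constant-on-edges) refl

looped : (H : Graph) → List (Fin (size H))
looped H = filter (λ v → T? (adj H v v)) (allFin (size H))

looped-embedding : ∀ H {ℓ} → ℓ ≤ loopCount H →
                   Σ (Fin ℓ → Fin (size H)) λ F → Injective _≡_ _≡_ F × (∀ i → T (adj H (F i) (F i)))
looped-embedding H {ℓ} ℓ≤loops = F , F-injective , F-looped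
  where
  ℓ≤ : ℓ ≤ length (looped H)
  ℓ≤ = subst (ℓ ≤_) (countᵇ≡length∘filter (λ v → adj H v v) (allFin (size H))) ℓ≤loops
  F : Fin ℓ → Fin (size H)
  F i = lookup (looped H) (inject≤ i ℓ≤)
  F-injective : Injective _≡_ _≡_ F
  F-injective = Finₚ.inject≤-injective ℓ≤ ℓ≤ _ _ ∘ lookup-injective looped-unique
    where
    looped-unique : Unique (looped H)
    looped-unique = Uniqueₚ.filter⁺ _ (Uniqueₚ.allFin⁺ (size H))
  F-looped : ∀ i → T (adj H (F i) (F i))
  F-looped i =
    proj₂ (∈-filter⁻ (λ v → T? (adj H v v)) {xs = allFin (size H)} (∈-lookup (inject≤ i ℓ≤)))

module ComponentHoms (H : Graph) (no-edges : NoEdgesBetweenDistinct H) (G : Graph) {λs : List ℕ}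
  (λs-positive : All (0 <_) λs) (λs↘ : Linked _≥ℕ_ λs) (components : ComponentSizes G λs) where

  private
    c : Fin (size G) → Fin (length λs)
    c = proj₁ components

    connected⇒same-component : ∀ u v → Connected G u v → c u ≡ c v
    connected⇒same-component = proj₁ (proj₂ components)

    same-component⇒connected : ∀ u v → c u ≡ c v → Connected G u v
    same-component⇒connected = proj₁ (proj₂ (proj₂ components))

    open Factored c (proj₂ (proj₂ (proj₂ components))) λs-positive

    hom-factors : ∀ {f} → IsHom G H f → f ≗ (f ∘ section) ∘ c
    hom-factors hom u = hom-constant-on-components {G = G} {H = H} no-edges hom
      (same-component⇒connected u (section (c u)) (sym (section-correct (c u))))

  hom-type : ∀ {f} → IsHom G H f → mapType f ≡ λs ⊎ length (mapType f) < length λs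
  hom-type {f} hom = subst (λ t → t ≡ λs ⊎ length t < length λs) (sym (mapType-cong (hom-factors hom)))
                           (mapType-∘ (f ∘ section) λs↘)

  homCount-off-diagonal : ∀ {μ} → length λs ≤ length μ → μ ≢ λs → homCount G H μ ≡ 0
  homCount-off-diagonal {μ} λs≤μ μ≢λs = ℕₚ.n≤0⇒n≡0 (ℕₚ.≮⇒≥ (no-hom ∘ homCount-pos⁻ G H))
    where
    no-hom : ¬ (∃ λ f → IsHom G H f × mapType f ≡ μ)
    no-hom (f , hom , type≡μ) with hom-type hom
    ... | inj₁ type≡λs = μ≢λs (trans (sym type≡μ) type≡λs)
    ... | inj₂ shorter = ℕₚ.<⇒≱ (subst (λ t → length t < length λs) type≡μ shorter) λs≤μ

  homCount-diagonal : length λs ≤ loopCount H → 0 < homCount G H λs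
  homCount-diagonal λs≤loops with looped-embedding H λs≤loops
  ... | F , F-injective , F-looped = homCount-pos⁺ G H hom (mapType-∘-injective F F-injective λs↘)
    where
    hom : IsHom G H (F ∘ c)
    hom u v uv rewrite connected⇒same-component u v (uv ◅ ε) = F-looped (c v)

ℕtoℚ-≢0 : ∀ k → .{{ℕ.NonZero k}} → ℕtoℚ k ≢ 0ℚ
ℕtoℚ-≢0 (suc k) = ≢-sym (ℚₚ.<⇒≢ (ℚₚ.positive⁻¹ _ {{ℚₚ.normalize-pos (suc k) 1}}))

mScale-nonZero : ∀ N μ → ℕ.NonZero (mScale N μ)
mScale-nonZero N μ = ℕₚ.m*n≢0 _ _ {{(N ∸ length μ) ℕₚ.!≢0}}
  {{product≢0 (Allₚ.map⁺ (All.universal (λ i → mult (suc i) μ ℕₚ.!≢0) (upTo (sum μ))))}}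

proposition4p8 :
    (n : ℕ) → 1 ≤ n →
    (H : Graph) → n ≤ size H → NoEdgesBetweenDistinct H → n ≤ loopCount H →
    (G : Partition n → Graph) → (∀ λ′ → ComponentSizes (G λ′) (parts λ′)) →
    IsBasis (λ λ′ μ → XGH (G λ′) H (parts μ))
proposition4p8 n _ H _ no-edges n≤loops G components =
  Triangular.isBasis (length ∘ parts) length-parts≤ X X-off-diagonal X-diagonal
  where
  module Homs (λ′ : Partition n) =
    ComponentHoms H no-edges (G λ′) (positive λ′) (decr λ′) (components λ′)

  X : Partition n → Sym n
  X λ′ μ = XGH (G λ′) H (parts μ)

  X-off-diagonal : ∀ λ′ μ → length (parts λ′) ≤ length (parts μ) → μ ≢ λ′ → X λ′ μ ≡ 0ℚ
  X-off-diagonal λ′ μ λ′≤μ μ≢λ′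
    rewrite Homs.homCount-off-diagonal λ′ λ′≤μ (μ≢λ′ ∘ parts-injective) = refl

  X-diagonal : ∀ λ′ → X λ′ λ′ ≢ 0ℚ
  X-diagonal λ′ = ℕtoℚ-≢0 _ {{ℕₚ.m*n≢0 _ _ {{ℕ.>-nonZero homs}} {{mScale-nonZero (size H) (parts λ′)}}}}
    where
    homs : 0 < homCount (G λ′) H (parts λ′)
    homs = Homs.homCount-diagonal λ′ (ℕₚ.≤-trans (length-parts≤ λ′) n≤loops)
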